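{- Let $G=(V,E)$ be a finite simple undirected graph, let $S\subseteq V$ be such that $G[S]$ is a tree, and let $F\subseteq V$ be arbitrary. Define the forbidden set $X=S\cup\{v\in V\setminus S:\mathrm{adj}(S,v)\ge 2\}\cup F$ and the candidate set $\mathit{CAND}=\{v\in V\setminus X:\mathrm{adj}(S,v)=1\}$. Let $u\in \mathit{CAND}$, let $S'=S\cup\{u\}$, $X'=X\cup\{u\}\cup(\mathit{CAND}\cap N(u))$, and $\mathit{CAND}'=\{v\in V\setminus X':\mathrm{adj}(S',v)=1\}$. Then $$\mathit{CAND}'=\big((\mathit{CAND}\setminus\{u\})\setminus N(u)\big)\cup\big(N(u)\setminus(\mathit{CAND}\cup X)\big).$$
   Context: $N(u)$ is the set of neighbours of $u$ in $G$, and $\mathrm{adj}(S,v)=|S\cap N(v)|$. $G[S]$ is the subgraph induced by $S$. The forbidden set $X$ consists of the vertices of $S$, the vertices whose addition to $S$ would create a cycle, and vertices $F$ that are forbidden for other reasons (by earlier branching decisions); the candidate set consists of the non-forbidden vertices whose addition to $S$ yields an induced subtree. When $u$ is added to $S$, the forbidden vertices $F$ stay the same. -}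

module Defs where

open import Data.Nat using (ℕ; _≤_; _≤ᵇ_; _≡ᵇ_)
open import Data.Bool using (Bool; true; false)
open import Data.Fin using (Fin)
open import Data.Fin.Subset public
  using (Subset; _∈_; _∉_; _∩_; _∪_; _─_; ∁; ⁅_⁆; ∣_∣; Nonempty)
open import Data.Vec using (tabulate)
open import Data.List using (List; _∷_; []; length; _∷ʳ_)
open import Data.List.Relation.Unary.All using (All)
open import Data.List.Relation.Unary.Linked using (Linked)
open import Data.List.Relation.Unary.Unique.Propositional using (Unique)
open import Data.Product using (Σ; _×_; ∃)
open import Relation.Binary.PropositionalEquality using (_≡_)
open import Relation.Nullary using (¬_)

record Graph (n : ℕ) : Set where
  field
    edge   : Fin n → Fin n → Bool
    sym    : ∀ u v → edge u v ≡ edge v u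
    irrefl : ∀ v → edge v v ≡ false

open Graph public

module _ {n : ℕ} (G : Graph n) where

  Adj : Fin n → Fin n → Set
  Adj u v = edge G u v ≡ true

  N : Fin n → Subset n
  N u = tabulate (λ v → edge G u v)

  adj : Subset n → Fin n → ℕ
  adj S v = ∣ S ∩ N v ∣

  data WalkIn (S : Subset n) : Fin n → Fin n → Set where
    stop : ∀ {x} → x ∈ S → WalkIn S x x
    step : ∀ {x z y} → x ∈ S → Adj x z → WalkIn S z y → WalkIn S x y

  ConnectedIn : Subset n → Set
  ConnectedIn S = ∀ x y → x ∈ S → y ∈ S → WalkIn S x y

  CycleIn : Subset n → Set
  CycleIn S = Σ (Fin n) λ x → Σ (List (Fin n)) λ rest →
      (3 ≤ length (x ∷ rest)) × Unique (x ∷ rest) × All (_∈ S) (x ∷ rest)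
    × Linked Adj ((x ∷ rest) ∷ʳ x)

  IsTree : Subset n → Set
  IsTree S = Nonempty S × ConnectedIn S × ¬ CycleIn S

  forbidden : Subset n → Subset n → Subset n
  forbidden S F =
    S ∪ ((tabulate (λ v → 2 ≤ᵇ adj S v)) ─ S) ∪ F

  cand : Subset n → Subset n → Subset n
  cand S X = tabulate (λ v → adj S v ≡ᵇ 1) ─ X

-- Since u ∉ S, adding u to S raises adj(·, v) by exactly [v ∈ N(u)]. So for
-- v ≠ u the new candidate condition adj(S', v) = 1 means: either adj(S, v) = 1
-- and v ∉ N(u) (an old candidate not swallowed by X'), or adj(S, v) = 0 and
-- v ∈ N(u). Membership of v in either side is thus a Boolean function of
-- adj(S, v), v ∈ X, v ∈ N(u) and v = u, and the two functions agree once one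
-- uses that adj(S, v) ≥ 2 forces v ∈ X and that u ∉ N(u).
module Submission where

open import Defs hiding (sym)
open import Data.Nat using (ℕ; zero; suc; _+_; _≤ᵇ_; _≡ᵇ_)
open import Data.Nat.Properties using (+-suc)
open import Data.Fin using (Fin; zero; suc)
open import Data.Bool using (Bool; true; false; _∧_; _∨_; not)
open import Data.Bool.Properties using (∧-zeroʳ; ∧-identityʳ)
open import Data.Vec using (_∷_; here; there; lookup; tabulate)
open import Data.Vec.Properties using (lookup-zipWith; lookup∘tabulate; tabulate∘lookup; tabulate-cong; lookup⇒[]=)
open import Data.Fin.Subset.Properties using (x∈⁅y⁆⇒x≡y; ∪-identityʳ; p⊆p∪q)
open import Data.Empty using (⊥-elim)
open import Relation.Binary.PropositionalEquality using (_≡_; refl; sym; trans; cong; cong₂; module ≡-Reasoning)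

toℕ : Bool → ℕ
toℕ true  = 1
toℕ false = 0

subset-ext : ∀ {n} {p q : Subset n} → (∀ i → lookup p i ≡ lookup q i) → p ≡ q
subset-ext {p = p} {q} eq = trans (sym (tabulate∘lookup p)) (trans (tabulate-cong eq) (tabulate∘lookup q))

lookup-∪ : ∀ {n} (p q : Subset n) i → lookup (p ∪ q) i ≡ lookup p i ∨ lookup q i
lookup-∪ p q i = lookup-zipWith _∨_ i p q

lookup-∩ : ∀ {n} (p q : Subset n) i → lookup (p ∩ q) i ≡ lookup p i ∧ lookup q i
lookup-∩ p q i = lookup-zipWith _∧_ i p q

lookup-─ : ∀ {n} (p q : Subset n) i → lookup (p ─ q) i ≡ lookup p i ∧ not (lookup q i)
lookup-─ (x ∷ p) (true  ∷ q) zero    = sym (∧-zeroʳ x)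
lookup-─ (x ∷ p) (false ∷ q) zero    = sym (∧-identityʳ x)
lookup-─ (x ∷ p) (y     ∷ q) (suc i) = lookup-─ p q i

x∈p─q⇒x∉q : ∀ {n} {x : Fin n} {p q : Subset n} → x ∈ p ─ q → x ∉ q
x∈p─q⇒x∉q {x = zero}  {p = _ ∷ _} {q = true  ∷ _} ()
x∈p─q⇒x∉q {x = zero}  {p = _ ∷ _} {q = false ∷ _} _             ()
x∈p─q⇒x∉q {x = suc _} {p = _ ∷ _} {q = _     ∷ _} (there x∈p─q) (there x∈q) = x∈p─q⇒x∉q x∈p─q x∈q

∣p∪⁅x⁆∩q∣ : ∀ {n} {x : Fin n} (p q : Subset n) → x ∉ p → ∣ (p ∪ ⁅ x ⁆) ∩ q ∣ ≡ toℕ (lookup q x) + ∣ p ∩ q ∣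
∣p∪⁅x⁆∩q∣ {x = zero}  (true  ∷ p) q           x∉p = ⊥-elim (x∉p here)
∣p∪⁅x⁆∩q∣ {x = zero}  (false ∷ p) (true  ∷ q) _   rewrite ∪-identityʳ p = refl
∣p∪⁅x⁆∩q∣ {x = zero}  (false ∷ p) (false ∷ q) _   rewrite ∪-identityʳ p = refl
∣p∪⁅x⁆∩q∣ {x = suc x} (true  ∷ p) (true  ∷ q) x∉p =
  trans (cong suc (∣p∪⁅x⁆∩q∣ p q (λ x∈p → x∉p (there x∈p)))) (sym (+-suc _ _))
∣p∪⁅x⁆∩q∣ {x = suc x} (true  ∷ p) (false ∷ q) x∉p = ∣p∪⁅x⁆∩q∣ p q (λ x∈p → x∉p (there x∈p))
∣p∪⁅x⁆∩q∣ {x = suc x} (false ∷ p) (b     ∷ q) x∉p = ∣p∪⁅x⁆∩q∣ p q (λ x∈p → x∉p (there x∈p))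

-- For a vertex v: a = adj(S, v), x = [v ∈ X], e = [v ∈ N(u)], isu = [v = u],
-- c = [v ∈ CAND]; the three hypotheses are all that is known about them.
cand-update-table : ∀ (a : ℕ) (x e isu c : Bool) → c ≡ (a ≡ᵇ 1) ∧ not x →
  ((2 ≤ᵇ a) ≡ true → x ≡ true) → (isu ≡ true → e ≡ false) →
  (toℕ e + a ≡ᵇ 1) ∧ not (x ∨ isu ∨ c ∧ e) ≡ (c ∧ not isu) ∧ not e ∨ e ∧ not (c ∨ x)
cand-update-table _             _     true  true  _ _    _  isu⇒¬e with () ← isu⇒¬e refl
cand-update-table (suc (suc _)) false _     _     _ _    2≤a⇒x _ with () ← 2≤a⇒x refl
cand-update-table (suc (suc _)) true  true  false _ refl _ _ = refl
cand-update-table (suc (suc _)) true  false _     _ refl _ _ = refl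
cand-update-table zero          true  true  false _ refl _ _ = refl
cand-update-table zero          true  false _     _ refl _ _ = refl
cand-update-table zero          false true  false _ refl _ _ = refl
cand-update-table zero          false false _     _ refl _ _ = refl
cand-update-table (suc zero)    true  true  false _ refl _ _ = refl
cand-update-table (suc zero)    true  false _     _ refl _ _ = refl
cand-update-table (suc zero)    false true  false _ refl _ _ = refl
cand-update-table (suc zero)    false false true  _ refl _ _ = refl
cand-update-table (suc zero)    false false false _ refl _ _ = refl

module _ {n : ℕ} (G : Graph n) where

  lookup-N : ∀ u v → lookup (N G u) v ≡ edge G u v
  lookup-N u v = lookup∘tabulate (edge G u) v

  lookup-cand : ∀ S X v → lookup (cand G S X) v ≡ (adj G S v ≡ᵇ 1) ∧ not (lookup X v)
  lookup-cand S X v = trans (lookup-─ single X v) (cong (_∧ not (lookup X v)) (lookup∘tabulate _ v))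
    where single = tabulate (λ w → adj G S w ≡ᵇ 1)

  lookup-forbidden : ∀ S F v →
    lookup (forbidden G S F) v ≡ lookup S v ∨ (2 ≤ᵇ adj G S v) ∧ not (lookup S v) ∨ lookup F v
  lookup-forbidden S F v =
    trans (lookup-∪ S ((many ─ S) ∪ F) v) (cong (lookup S v ∨_)
      (trans (lookup-∪ (many ─ S) F v) (cong (_∨ lookup F v)
        (trans (lookup-─ many S v) (cong (_∧ not (lookup S v)) (lookup∘tabulate _ v))))))
    where many = tabulate (λ w → 2 ≤ᵇ adj G S w)

  2≤adj⇒forbidden : ∀ S F v → (2 ≤ᵇ adj G S v) ≡ true → lookup (forbidden G S F) v ≡ true
  2≤adj⇒forbidden S F v 2≤a = trans (lookup-forbidden S F v) (many-neighbours (lookup S v) 2≤a)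
    where
    many-neighbours : ∀ {b} s {f} → b ≡ true → s ∨ b ∧ not s ∨ f ≡ true
    many-neighbours true  _    = refl
    many-neighbours false refl = refl

  adj-∪⁅⁆ : ∀ {S u} v → u ∉ S → adj G (S ∪ ⁅ u ⁆) v ≡ toℕ (edge G u v) + adj G S v
  adj-∪⁅⁆ {S} {u} v u∉S = trans (∣p∪⁅x⁆∩q∣ S (N G v) u∉S)
    (cong (λ b → toℕ b + adj G S v) (trans (lookup-N v u) (Graph.sym G v u)))

  ∈⁅u⁆⇒¬edge : ∀ u v → lookup ⁅ u ⁆ v ≡ true → edge G u v ≡ false
  ∈⁅u⁆⇒¬edge u v v∈⁅u⁆ with refl ← x∈⁅y⁆⇒x≡y u (lookup⇒[]= v ⁅ u ⁆ v∈⁅u⁆) = Graph.irrefl G u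

lemma2 : {n : ℕ} (G : Graph n) (S F : Subset n) (u : Fin n) → IsTree G S → u ∈ cand G S (forbidden G S F)
    → let X = forbidden G S F
          CAND = cand G S X
          S' = S ∪ ⁅ u ⁆
          X' = X ∪ ⁅ u ⁆ ∪ (CAND ∩ N G u)
          CAND' = cand G S' X'
      in CAND' ≡ ((CAND ─ ⁅ u ⁆) ─ N G u) ∪ (N G u ─ (CAND ∪ X))
lemma2 G S F u _ u∈CAND = subset-ext pointwise
  where
  X    = forbidden G S F
  CAND = cand G S X
  X'   = X ∪ ⁅ u ⁆ ∪ (CAND ∩ N G u)
  RHS  = ((CAND ─ ⁅ u ⁆) ─ N G u) ∪ (N G u ─ (CAND ∪ X))

  u∉S : u ∉ S
  u∉S u∈S = x∈p─q⇒x∉q u∈CAND (p⊆p∪q _ u∈S)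

  pointwise : ∀ v → lookup (cand G (S ∪ ⁅ u ⁆) X') v ≡ lookup RHS v
  pointwise v = begin
    lookup (cand G (S ∪ ⁅ u ⁆) X') v                ≡⟨ lookup-cand G (S ∪ ⁅ u ⁆) X' v ⟩
    (adj G (S ∪ ⁅ u ⁆) v ≡ᵇ 1) ∧ not (lookup X' v)  ≡⟨ cong₂ (λ a y → (a ≡ᵇ 1) ∧ not y) (adj-∪⁅⁆ G v u∉S) lookup-X' ⟩
    (toℕ e + a ≡ᵇ 1) ∧ not (x ∨ isu ∨ c ∧ e)
      ≡⟨ cand-update-table a x e isu c (lookup-cand G S X v) (2≤adj⇒forbidden G S F v) (∈⁅u⁆⇒¬edge G u v) ⟩
    (c ∧ not isu) ∧ not e ∨ e ∧ not (c ∨ x)         ≡⟨ lookup-RHS ⟨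
    lookup RHS v                                    ∎
    where
    open ≡-Reasoning
    a   = adj G S v
    x   = lookup X v
    e   = edge G u v
    isu = lookup ⁅ u ⁆ v
    c   = lookup CAND v

    lookup-X' : lookup X' v ≡ x ∨ isu ∨ c ∧ e
    lookup-X' rewrite lookup-∪ X (⁅ u ⁆ ∪ (CAND ∩ N G u)) v | lookup-∪ ⁅ u ⁆ (CAND ∩ N G u) v
                    | lookup-∩ CAND (N G u) v | lookup-N G u v = refl

    lookup-RHS : lookup RHS v ≡ (c ∧ not isu) ∧ not e ∨ e ∧ not (c ∨ x)
    lookup-RHS rewrite lookup-∪ ((CAND ─ ⁅ u ⁆) ─ N G u) (N G u ─ (CAND ∪ X)) v
                     | lookup-─ (CAND ─ ⁅ u ⁆) (N G u) v | lookup-─ CAND ⁅ u ⁆ v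
                     | lookup-─ (N G u) (CAND ∪ X) v | lookup-∪ CAND X v | lookup-N G u v = refl
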